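{- Let $G$ be a finite, connected, biconnected simple graph and let $(x,y)$ be an edge of $G$. Then the order of $[\delta_{xy}]$ in $\mathrm{Jac}(G)$ satisfies $$|[\delta_{xy}]|_{\mathrm{Jac}(G)}\ \ge\ \mathrm{val}(x)+\frac{\mathrm{val}(x)-1}{\mathrm{val}(y)-1}.$$
   Context: $\mathrm{val}(v)$ is the number of edges incident to $v$. Biconnected means that removing any single vertex leaves a connected graph. A divisor is an element of $\mathbb{Z}^{V(G)}$; $\mathrm{Div}^0(G)$ is the group of divisors with values summing to zero. The Laplacian is $L=\Delta-A$ with $\Delta$ the diagonal matrix of valencies and $A$ the adjacency matrix; $\mathrm{Jac}(G)=\mathrm{Div}^0(G)/\{L\sigma:\sigma\in\mathbb{Z}^{V(G)}\}$. $\delta_{xy}$ is the divisor with $-1$ at $x$, $1$ at $y$ and $0$ elsewhere. -}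

module Defs where

open import Data.Nat using (ℕ; zero; suc; _<_; _≤_)
open import Data.Bool using (Bool; true; false; if_then_else_)
open import Data.Fin using (Fin; zero; suc)
open import Data.Integer as ℤ using (ℤ; +_)
open import Data.Product using (Σ; _×_; ∃)
open import Relation.Binary.PropositionalEquality using (_≡_; _≢_)
open import Relation.Nullary using (¬_)

sumℕ : ∀ {n} → (Fin n → ℕ) → ℕ
sumℕ {zero}  f = 0
sumℕ {suc n} f = f zero Data.Nat.+ sumℕ (λ i → f (suc i))

sumℤ : ∀ {n} → (Fin n → ℤ) → ℤ
sumℤ {zero}  f = + 0
sumℤ {suc n} f = f zero ℤ.+ sumℤ (λ i → f (suc i))

record SimpleGraph (n : ℕ) : Set where
  field
    adj       : Fin n → Fin n → Bool
    adj-sym   : ∀ u v → adj u v ≡ adj v u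
    adj-irrefl : ∀ v → adj v v ≡ false
open SimpleGraph public

val : ∀ {n} → SimpleGraph n → Fin n → ℕ
val G v = sumℕ (λ w → if adj G v w then 1 else 0)

data WalkIn {n} (G : SimpleGraph n) (P : Fin n → Set) : Fin n → Fin n → Set where
  here : ∀ {u} → P u → WalkIn G P u u
  step : ∀ {u v w} → P u → adj G u v ≡ true → WalkIn G P v w → WalkIn G P u w

Connected : ∀ {n} → SimpleGraph n → Set
Connected {n} G = ∀ (u w : Fin n) → WalkIn G (λ _ → Data.Unit.⊤) u w
  where import Data.Unit

Biconnected : ∀ {n} → SimpleGraph n → Set
Biconnected {n} G = ∀ (z u w : Fin n) → u ≢ z → w ≢ z → WalkIn G (λ v → v ≢ z) u w

Divisor : ℕ → Set
Divisor n = Fin n → ℤ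

laplacian : ∀ {n} → SimpleGraph n → Divisor n → Divisor n
laplacian G σ v =
  (+ val G v) ℤ.* σ v ℤ.- sumℤ (λ w → if adj G v w then σ w else + 0)

-- D lies in the image of L, i.e. [D] = 0 in Jac(G)
InImageL : ∀ {n} → SimpleGraph n → Divisor n → Set
InImageL {n} G D = Σ (Divisor n) λ σ → ∀ v → D v ≡ laplacian G σ v

δ : ∀ {n} → Fin n → Fin n → Divisor n
δ x y v with x Data.Fin.≟ v | y Data.Fin.≟ v
... | Relation.Nullary.yes _ | _ = ℤ.- (+ 1)
... | Relation.Nullary.no _  | Relation.Nullary.yes _ = + 1
... | Relation.Nullary.no _  | Relation.Nullary.no _ = + 0

_·_ : ∀ {n} → ℕ → Divisor n → Divisor n
(k · D) v = + k ℤ.* D v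

Kills : ∀ {n} → SimpleGraph n → ℕ → Divisor n → Set
Kills G k D = InImageL G (k · D)

IsOrderInJac : ∀ {n} → SimpleGraph n → Divisor n → ℕ → Set
IsOrderInJac G D k =
  (0 < k) × Kills G k D × (∀ j → 0 < j → j < k → ¬ Kills G j D)

-- Write k·δ_xy = Lσ. Away from x the divisor is nonnegative, so σ is superharmonic on V ∖ {x}:
-- a minimum of σ there spreads along walks avoiding x (which exist by biconnectivity) to y,
-- where (Lσ)(y) = k > 0 rules out a minimum. Hence x is the strict minimum of σ. With
-- d = σ(y) − σ(x) − 1 ≥ 0, the terms of (Lσ)(x) = −k are ≤ −1, the y-term being −(d+1), so
-- val(x) + d ≤ k; the terms of (Lσ)(y) = k are ≤ d, the x-term being d+1, so k ≤ val(y)·d + 1.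
-- Eliminating d gives the bound.
module Submission where

open import Defs
open import Data.Nat using (ℕ; _≤_; _+_; _*_; _∸_)
open import Data.Bool using (true)
open import Data.Fin using (Fin)
open import Relation.Binary.PropositionalEquality using (_≡_)

open import Data.Nat as ℕ using (zero; suc; z≤n)
import Data.Nat.Properties as ℕ
open import Data.Bool using (Bool; false; if_then_else_)
open import Data.Fin as Fin using (zero; suc; _≟_)
import Data.Fin.Properties as Fin
open import Data.Integer as ℤ using (ℤ; +_; 0ℤ; 1ℤ; -1ℤ; -_)
import Data.Integer.Properties as ℤ
open import Data.Integer.Tactic.RingSolver using (solve-∀)
open import Data.List using (allFin)
open import Data.List.Relation.Unary.All using (lookup)
open import Data.List.Membership.Propositional.Properties using (∈-allFin)
open import Data.List.Extrema ℤ.≤-totalOrder using (argmin; f[argmin]≤f[xs])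
open import Data.Product using (∃; _,_)
open import Function using (_∘_)
open import Relation.Nullary using (yes; no; contradiction)
open import Relation.Binary.PropositionalEquality
  using (refl; sym; trans; cong; cong₂; subst; subst₂; _≢_; module ≡-Reasoning)

sumℤ-cong : ∀ {n} {f g : Fin n → ℤ} → (∀ w → f w ≡ g w) → sumℤ f ≡ sumℤ g
sumℤ-cong {zero}  f≗g = refl
sumℤ-cong {suc n} f≗g = cong₂ ℤ._+_ (f≗g zero) (sumℤ-cong (λ w → f≗g (suc w)))

sumℤ-zero : ∀ n → sumℤ {n} (λ _ → 0ℤ) ≡ 0ℤ
sumℤ-zero zero    = refl
sumℤ-zero (suc n) = trans (ℤ.+-identityˡ _) (sumℤ-zero n)

sumℤ-distrib-- : ∀ {n} (f g : Fin n → ℤ) → sumℤ (λ w → f w ℤ.- g w) ≡ sumℤ f ℤ.- sumℤ g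
sumℤ-distrib-- {zero}  f g = refl
sumℤ-distrib-- {suc n} f g = begin
  (f zero ℤ.- g zero) ℤ.+ sumℤ (λ w → f (suc w) ℤ.- g (suc w))
    ≡⟨ cong (λ t → (f zero ℤ.- g zero) ℤ.+ t) (sumℤ-distrib-- (λ w → f (suc w)) (λ w → g (suc w))) ⟩
  (f zero ℤ.- g zero) ℤ.+ (sumℤ (λ w → f (suc w)) ℤ.- sumℤ (λ w → g (suc w)))
    ≡⟨ swap (f zero) (g zero) _ _ ⟩
  (f zero ℤ.+ sumℤ (λ w → f (suc w))) ℤ.- (g zero ℤ.+ sumℤ (λ w → g (suc w))) ∎
  where
  open ≡-Reasoning
  swap : ∀ a b c d → (a ℤ.- b) ℤ.+ (c ℤ.- d) ≡ (a ℤ.+ c) ℤ.- (b ℤ.+ d)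
  swap = solve-∀

sumℤ-indicator : ∀ {n} (p : Fin n → Bool) (c : ℤ) →
  sumℤ (λ w → if p w then c else 0ℤ) ≡ + sumℕ (λ w → if p w then 1 else 0) ℤ.* c
sumℤ-indicator {zero}  p c = refl
sumℤ-indicator {suc n} p c with p zero
... | true  = trans (cong (λ t → c ℤ.+ t) (sumℤ-indicator (λ w → p (suc w)) c))
                    (sym (ℤ.suc-* (+ sumℕ (λ w → if p (suc w) then 1 else 0)) c))
... | false = trans (ℤ.+-identityˡ _) (sumℤ-indicator (λ w → p (suc w)) c)

sumℤ-mono-≤ : ∀ {n} {f g : Fin n → ℤ} → (∀ w → f w ℤ.≤ g w) → sumℤ f ℤ.≤ sumℤ g
sumℤ-mono-≤ {zero}  f≤g = ℤ.≤-refl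
sumℤ-mono-≤ {suc n} f≤g = ℤ.+-mono-≤ (f≤g zero) (sumℤ-mono-≤ (λ w → f≤g (suc w)))

sumℤ-mono-≤-except : ∀ {n} {f g : Fin n → ℤ} (u : Fin n) → (∀ w → w ≢ u → f w ℤ.≤ g w) →
  sumℤ f ℤ.+ g u ℤ.≤ sumℤ g ℤ.+ f u
sumℤ-mono-≤-except {suc n} {f} {g} zero f≤g = begin
  (f zero ℤ.+ Σf) ℤ.+ g zero ≡⟨ exchange (f zero) Σf (g zero) ⟩
  (g zero ℤ.+ Σf) ℤ.+ f zero ≤⟨ ℤ.+-monoˡ-≤ (f zero) (ℤ.+-monoʳ-≤ (g zero) Σf≤Σg) ⟩
  (g zero ℤ.+ Σg) ℤ.+ f zero ∎
  where
  open ℤ.≤-Reasoning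
  Σf = sumℤ (λ w → f (suc w))
  Σg = sumℤ (λ w → g (suc w))
  Σf≤Σg : Σf ℤ.≤ Σg
  Σf≤Σg = sumℤ-mono-≤ (λ w → f≤g (suc w) (λ ()))
  exchange : ∀ a s b → (a ℤ.+ s) ℤ.+ b ≡ (b ℤ.+ s) ℤ.+ a
  exchange = solve-∀
sumℤ-mono-≤-except {suc n} {f} {g} (suc u) f≤g = begin
  (f zero ℤ.+ Σf) ℤ.+ g (suc u) ≡⟨ ℤ.+-assoc (f zero) Σf (g (suc u)) ⟩
  f zero ℤ.+ (Σf ℤ.+ g (suc u)) ≤⟨ ℤ.+-mono-≤ (f≤g zero λ ()) rest ⟩
  g zero ℤ.+ (Σg ℤ.+ f (suc u)) ≡⟨ ℤ.+-assoc (g zero) Σg (f (suc u)) ⟨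
  (g zero ℤ.+ Σg) ℤ.+ f (suc u) ∎
  where
  open ℤ.≤-Reasoning
  Σf = sumℤ (λ w → f (suc w))
  Σg = sumℤ (λ w → g (suc w))
  rest : Σf ℤ.+ g (suc u) ℤ.≤ Σg ℤ.+ f (suc u)
  rest = sumℤ-mono-≤-except u (λ w w≢u → f≤g (suc w) (w≢u ∘ Fin.suc-injective))

adjacent⇒≢ : ∀ {n} (G : SimpleGraph n) {u v : Fin n} → adj G u v ≡ true → u ≢ v
adjacent⇒≢ G {u} u~v refl with trans (sym u~v) (adj-irrefl G u)
... | ()

δ-source : ∀ {n} (x y : Fin n) → δ x y x ≡ -1ℤ
δ-source x y with x ≟ x
... | yes _   = refl
... | no x≢x  = contradiction refl x≢x

δ-target : ∀ {n} {x y : Fin n} → x ≢ y → δ x y y ≡ 1ℤ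
δ-target {x = x} {y} x≢y with x ≟ y | y ≟ y
... | yes x≡y | _       = contradiction x≡y x≢y
... | no _    | yes _   = refl
... | no _    | no y≢y  = contradiction refl y≢y

δ-nonneg : ∀ {n} (x y : Fin n) {u : Fin n} → u ≢ x → 0ℤ ℤ.≤ δ x y u
δ-nonneg x y {u} u≢x with x ≟ u | y ≟ u
... | yes x≡u | _     = contradiction (sym x≡u) u≢x
... | no _    | yes _ = ℤ.+≤+ z≤n
... | no _    | no _  = ℤ.≤-refl

minimiser : ∀ {n} → Fin n → (σ : Fin n → ℤ) → ∃ λ v → ∀ w → σ v ℤ.≤ σ w
minimiser {n} x σ =
  argmin σ x (allFin n) , λ w → lookup (f[argmin]≤f[xs] x (allFin n)) (∈-allFin w)

module _ {n} (G : SimpleGraph n) (σ : Divisor n) where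

  IsMinimum : Fin n → Set
  IsMinimum u = ∀ w → σ u ℤ.≤ σ w

  laplacian-≡-sum : ∀ v → laplacian G σ v ≡ sumℤ (λ w → if adj G v w then σ v ℤ.- σ w else 0ℤ)
  laplacian-≡-sum v = begin
    + val G v ℤ.* σ v ℤ.- sumℤ (around σ)               ≡⟨ cong (ℤ._- sumℤ (around σ)) Σσv ⟨
    sumℤ (around (λ _ → σ v)) ℤ.- sumℤ (around σ)       ≡⟨ sumℤ-distrib-- _ (around σ) ⟨
    sumℤ (λ w → around (λ _ → σ v) w ℤ.- around σ w)    ≡⟨ sumℤ-cong around-distrib-- ⟩
    sumℤ (around (λ w → σ v ℤ.- σ w))                   ∎
    where
    open ≡-Reasoning
    around : (Fin n → ℤ) → Fin n → ℤ
    around h w = if adj G v w then h w else 0ℤ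
    Σσv : sumℤ (around (λ _ → σ v)) ≡ + val G v ℤ.* σ v
    Σσv = sumℤ-indicator (adj G v) (σ v)
    around-distrib-- : ∀ w → around (λ _ → σ v) w ℤ.- around σ w ≡ around (λ w → σ v ℤ.- σ w) w
    around-distrib-- w with adj G v w
    ... | true  = refl
    ... | false = refl

  laplacian-≤-via-neighbour : ∀ {v u} → adj G v u ≡ true → (c : ℤ) →
    (∀ w → w ≢ u → adj G v w ≡ true → σ v ℤ.- σ w ℤ.≤ c) →
    laplacian G σ v ℤ.+ c ℤ.≤ (σ v ℤ.- σ u) ℤ.+ + val G v ℤ.* c
  laplacian-≤-via-neighbour {v} {u} v~u c bound = begin
    laplacian G σ v ℤ.+ c               ≡⟨ cong₂ ℤ._+_ (laplacian-≡-sum v) (sym g[u]≡c) ⟩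
    sumℤ f ℤ.+ g u                      ≤⟨ sumℤ-mono-≤-except u f≤g ⟩
    sumℤ g ℤ.+ f u                      ≡⟨ cong₂ ℤ._+_ (sumℤ-indicator (adj G v) c) f[u]≡ ⟩
    + val G v ℤ.* c ℤ.+ (σ v ℤ.- σ u)   ≡⟨ ℤ.+-comm (+ val G v ℤ.* c) (σ v ℤ.- σ u) ⟩
    (σ v ℤ.- σ u) ℤ.+ + val G v ℤ.* c   ∎
    where
    open ℤ.≤-Reasoning
    f g : Fin n → ℤ
    f w = if adj G v w then σ v ℤ.- σ w else 0ℤ
    g w = if adj G v w then c else 0ℤ
    f[u]≡ : f u ≡ σ v ℤ.- σ u
    f[u]≡ = cong (λ b → if b then σ v ℤ.- σ u else 0ℤ) v~u
    g[u]≡c : g u ≡ c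
    g[u]≡c = cong (λ b → if b then c else 0ℤ) v~u
    f≤g : ∀ w → w ≢ u → f w ℤ.≤ g w
    f≤g w w≢u with adj G v w in v~w
    ... | true  = bound w w≢u v~w
    ... | false = ℤ.≤-refl

  laplacian-nonpos-at-minimum : ∀ {u} → IsMinimum u → laplacian G σ u ℤ.≤ 0ℤ
  laplacian-nonpos-at-minimum {u} min = begin
    laplacian G σ u                                        ≡⟨ laplacian-≡-sum u ⟩
    sumℤ (λ w → if adj G u w then σ u ℤ.- σ w else 0ℤ)     ≤⟨ sumℤ-mono-≤ term≤0 ⟩
    sumℤ {n} (λ _ → 0ℤ)                                    ≡⟨ sumℤ-zero n ⟩
    0ℤ                                                     ∎
    where
    open ℤ.≤-Reasoning
    term≤0 : ∀ w → (if adj G u w then σ u ℤ.- σ w else 0ℤ) ℤ.≤ 0ℤ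
    term≤0 w with adj G u w
    ... | true  = ℤ.i≤j⇒i-j≤0 (min w)
    ... | false = ℤ.≤-refl

  minimum-spreads : ∀ {u v} → IsMinimum u → 0ℤ ℤ.≤ laplacian G σ u → adj G u v ≡ true → IsMinimum v
  minimum-spreads {u} {v} min 0≤Lu u~v w = ℤ.≤-trans σv≤σu (min w)
    where
    open ℤ.≤-Reasoning
    0≤σu-σv : 0ℤ ℤ.≤ σ u ℤ.- σ v
    0≤σu-σv = begin
      0ℤ                                   ≤⟨ 0≤Lu ⟩
      laplacian G σ u                      ≡⟨ ℤ.+-identityʳ _ ⟨
      laplacian G σ u ℤ.+ 0ℤ               ≤⟨ laplacian-≤-via-neighbour u~v 0ℤ descends ⟩
      (σ u ℤ.- σ v) ℤ.+ + val G u ℤ.* 0ℤ   ≡⟨ cong (λ t → (σ u ℤ.- σ v) ℤ.+ t) (ℤ.*-zeroʳ (+ val G u)) ⟩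
      (σ u ℤ.- σ v) ℤ.+ 0ℤ                 ≡⟨ ℤ.+-identityʳ _ ⟩
      σ u ℤ.- σ v                          ∎
      where
      descends : ∀ w → w ≢ v → adj G u w ≡ true → σ u ℤ.- σ w ℤ.≤ 0ℤ
      descends w _ _ = ℤ.i≤j⇒i-j≤0 (min w)
    σv≤σu : σ v ℤ.≤ σ u
    σv≤σu = ℤ.0≤i-j⇒j≤i 0≤σu-σv

  minimum-spreads-along : ∀ {P : Fin n → Set} → (∀ {v} → P v → 0ℤ ℤ.≤ laplacian G σ v) →
    ∀ {u w} → WalkIn G P u w → IsMinimum u → IsMinimum w
  minimum-spreads-along superharmonic (here _)          min = min
  minimum-spreads-along superharmonic (step Pu u~v walk) min =
    minimum-spreads-along superharmonic walk (minimum-spreads min (superharmonic Pu) u~v)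

source-bound⇒ : ∀ {k a d : ℕ} → - (+ k) ℤ.+ -1ℤ ℤ.≤ - (1ℤ ℤ.+ + d) ℤ.+ + a ℤ.* -1ℤ → a + d ≤ k
source-bound⇒ {k} {a} {d} le =
  ℕ.s≤s⁻¹ (subst (_≤ suc k) (ℕ.+-suc a d) (ℤ.drop‿+≤+ (ℤ.neg-cancel-≤ le′)))
  where
  le′ : - (1ℤ ℤ.+ + k) ℤ.≤ - (+ a ℤ.+ (1ℤ ℤ.+ + d))
  le′ = subst₂ ℤ._≤_ (negate-left (+ k)) (negate-right (+ d) (+ a)) le
    where
    negate-left : ∀ K → - K ℤ.+ -1ℤ ≡ - (1ℤ ℤ.+ K)
    negate-left = solve-∀
    negate-right : ∀ D A → - (1ℤ ℤ.+ D) ℤ.+ A ℤ.* -1ℤ ≡ - (A ℤ.+ (1ℤ ℤ.+ D))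
    negate-right = solve-∀

target-bound⇒ : ∀ {k b d : ℕ} → + k ℤ.+ + d ℤ.≤ (1ℤ ℤ.+ + d) ℤ.+ + b ℤ.* + d → k ≤ suc (b * d)
target-bound⇒ {k} {b} {d} le = ℕ.+-cancelʳ-≤ d k (suc (b * d)) k+d≤[1+bd]+d
  where
  k+d≤[1+bd]+d : k + d ≤ suc (b * d) + d
  k+d≤[1+bd]+d = subst (k + d ≤_) (cong suc (ℕ.+-comm d (b * d))) (ℤ.drop‿+≤+ le′)
    where
    le′ : + k ℤ.+ + d ℤ.≤ (1ℤ ℤ.+ + d) ℤ.+ + (b * d)
    le′ = subst (λ t → + k ℤ.+ + d ℤ.≤ (1ℤ ℤ.+ + d) ℤ.+ t) (sym (ℤ.pos-* b d)) le

order-bound : ∀ {a b k d : ℕ} → a + d ≤ k → k ≤ suc (b * d) → (b ∸ 1) * a + (a ∸ 1) ≤ (b ∸ 1) * k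
order-bound {a} {zero} {k} {d} a+d≤k k≤1 =
  ℕ.≤-trans (ℕ.∸-monoˡ-≤ 1 (ℕ.≤-trans (ℕ.m≤m+n a d) (ℕ.≤-trans a+d≤k k≤1))) ℕ.≤-refl
order-bound {a} {suc b} {k} {d} a+d≤k k≤1+[1+b]d = begin
  b * a + (a ∸ 1) ≤⟨ ℕ.+-monoʳ-≤ (b * a) a∸1≤bd ⟩
  b * a + b * d   ≡⟨ ℕ.*-distribˡ-+ b a d ⟨
  b * (a + d)     ≤⟨ ℕ.*-monoʳ-≤ b a+d≤k ⟩
  b * k           ∎
  where
  open ℕ.≤-Reasoning
  a+d≤[1+bd]+d : a + d ≤ suc (b * d) + d
  a+d≤[1+bd]+d = ℕ.≤-trans a+d≤k (subst (k ≤_) (cong suc (ℕ.+-comm d (b * d))) k≤1+[1+b]d)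
  a∸1≤bd : a ∸ 1 ≤ b * d
  a∸1≤bd = ℕ.∸-monoˡ-≤ 1 (ℕ.+-cancelʳ-≤ d a (suc (b * d)) a+d≤[1+bd]+d)

module OrderOfEdgeDivisor
  {n} {G : SimpleGraph n} (bic : Biconnected G) {x y : Fin n} (x~y : adj G x y ≡ true)
  {k : ℕ} (k>0 : 0 ℕ.< k) {σ : Divisor n} (kδ≡Lσ : ∀ v → (k · δ x y) v ≡ laplacian G σ v)
  where

  x≢y : x ≢ y
  x≢y = adjacent⇒≢ G x~y

  laplacian-source : laplacian G σ x ≡ - (+ k)
  laplacian-source = begin
    laplacian G σ x   ≡⟨ kδ≡Lσ x ⟨
    + k ℤ.* δ x y x   ≡⟨ cong (λ t → + k ℤ.* t) (δ-source x y) ⟩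
    + k ℤ.* -1ℤ       ≡⟨ ℤ.*-comm (+ k) -1ℤ ⟩
    -1ℤ ℤ.* + k       ≡⟨ ℤ.-1*i≡-i (+ k) ⟩
    - (+ k)           ∎
    where open ≡-Reasoning

  laplacian-target : laplacian G σ y ≡ + k
  laplacian-target = begin
    laplacian G σ y   ≡⟨ kδ≡Lσ y ⟨
    + k ℤ.* δ x y y   ≡⟨ cong (λ t → + k ℤ.* t) (δ-target x≢y) ⟩
    + k ℤ.* 1ℤ        ≡⟨ ℤ.*-identityʳ (+ k) ⟩
    + k               ∎
    where open ≡-Reasoning

  laplacian-nonneg : ∀ {w} → w ≢ x → 0ℤ ℤ.≤ laplacian G σ w
  laplacian-nonneg {w} w≢x = subst (0ℤ ℤ.≤_) (kδ≡Lσ w)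
    (subst (ℤ._≤ + k ℤ.* δ x y w) (ℤ.*-zeroʳ (+ k)) (ℤ.*-monoˡ-≤-nonNeg (+ k) (δ-nonneg x y w≢x)))

  minimum-is-source : ∀ {w} → IsMinimum G σ w → w ≡ x
  minimum-is-source {w} min with w ≟ x
  ... | yes w≡x = w≡x
  ... | no  w≢x = contradiction (ℤ.drop‿+≤+ k≤0) (ℕ.<⇒≱ k>0)
    where
    y-min : IsMinimum G σ y
    y-min = minimum-spreads-along G σ laplacian-nonneg (bic x w y w≢x (x≢y ∘ sym)) min
    k≤0 : + k ℤ.≤ 0ℤ
    k≤0 = subst (ℤ._≤ 0ℤ) laplacian-target (laplacian-nonpos-at-minimum G σ y-min)

  source-strict-minimum : ∀ {w} → w ≢ x → σ x ℤ.< σ w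
  source-strict-minimum {w} w≢x =
    ℤ.≰⇒> λ σw≤σx → w≢x (minimum-is-source (λ z → ℤ.≤-trans σw≤σx (x-min z)))
    where
    x-min : IsMinimum G σ x
    x-min with minimiser x σ
    ... | v , v-min = subst (IsMinimum G σ) (minimum-is-source v-min) v-min

  descent : ∀ v {w} → w ≢ x → σ v ℤ.- σ w ℤ.≤ σ v ℤ.- ℤ.suc (σ x)
  descent v w≢x = ℤ.+-monoʳ-≤ (σ v) (ℤ.neg-mono-≤ (ℤ.i<j⇒suc[i]≤j (source-strict-minimum w≢x)))

  gap : ℕ
  gap = ℤ.∣ σ y ℤ.- ℤ.suc (σ x) ∣

  gap-≡ : + gap ≡ σ y ℤ.- ℤ.suc (σ x)
  gap-≡ = ℤ.0≤i⇒+∣i∣≡i (ℤ.i≤j⇒0≤j-i (ℤ.i<j⇒suc[i]≤j (source-strict-minimum (x≢y ∘ sym))))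

  source-bound : val G x + gap ≤ k
  source-bound = source-bound⇒ {a = val G x} (begin
    - (+ k) ℤ.+ -1ℤ                          ≡⟨ cong (ℤ._+ -1ℤ) laplacian-source ⟨
    laplacian G σ x ℤ.+ -1ℤ                  ≤⟨ laplacian-≤-via-neighbour G σ x~y -1ℤ below-neighbours ⟩
    (σ x ℤ.- σ y) ℤ.+ + val G x ℤ.* -1ℤ      ≡⟨ cong (ℤ._+ (+ val G x ℤ.* -1ℤ)) σx-σy≡ ⟩
    - (1ℤ ℤ.+ + gap) ℤ.+ + val G x ℤ.* -1ℤ   ∎)
    where
    open ℤ.≤-Reasoning
    below-neighbours : ∀ w → w ≢ y → adj G x w ≡ true → σ x ℤ.- σ w ℤ.≤ -1ℤ
    below-neighbours w _ x~w = ℤ.≤-trans (descent x (adjacent⇒≢ G x~w ∘ sym)) (ℤ.≤-reflexive (i-suc[i]≡-1 (σ x)))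
      where
      i-suc[i]≡-1 : ∀ i → i ℤ.- (1ℤ ℤ.+ i) ≡ -1ℤ
      i-suc[i]≡-1 = solve-∀
    σx-σy≡ : σ x ℤ.- σ y ≡ - (1ℤ ℤ.+ + gap)
    σx-σy≡ = trans (flip (σ x) (σ y)) (cong (λ t → - (1ℤ ℤ.+ t)) (sym gap-≡))
      where
      flip : ∀ i j → i ℤ.- j ≡ - (1ℤ ℤ.+ (j ℤ.- (1ℤ ℤ.+ i)))
      flip = solve-∀

  target-bound : k ≤ suc (val G y * gap)
  target-bound = target-bound⇒ {b = val G y} (begin
    + k ℤ.+ + gap                             ≡⟨ cong₂ ℤ._+_ laplacian-target (sym gap-≡) ⟨
    laplacian G σ y ℤ.+ c                     ≤⟨ laplacian-≤-via-neighbour G σ y~x c (λ _ w≢x _ → descent y w≢x) ⟩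
    (σ y ℤ.- σ x) ℤ.+ + val G y ℤ.* c         ≡⟨ cong₂ (λ s t → s ℤ.+ + val G y ℤ.* t) σy-σx≡ (sym gap-≡) ⟩
    (1ℤ ℤ.+ + gap) ℤ.+ + val G y ℤ.* + gap    ∎)
    where
    open ℤ.≤-Reasoning
    c = σ y ℤ.- ℤ.suc (σ x)
    y~x : adj G y x ≡ true
    y~x = trans (adj-sym G y x) x~y
    σy-σx≡ : σ y ℤ.- σ x ≡ 1ℤ ℤ.+ + gap
    σy-σx≡ = trans (shift (σ x) (σ y)) (cong (λ t → 1ℤ ℤ.+ t) (sym gap-≡))
      where
      shift : ∀ i j → j ℤ.- i ≡ 1ℤ ℤ.+ (j ℤ.- (1ℤ ℤ.+ i))
      shift = solve-∀

proposition5p2 : ∀ {n : ℕ} (G : SimpleGraph n) → Connected G → Biconnected G →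
    ∀ (x y : Fin n) → adj G x y ≡ true →
    ∀ (k : ℕ) → IsOrderInJac G (δ x y) k →
    (val G y ∸ 1) * val G x + (val G x ∸ 1) ≤ (val G y ∸ 1) * k
proposition5p2 G _ bic x y x~y k (k>0 , (σ , kδ≡Lσ) , _) =
  order-bound {a = val G x} {b = val G y} source-bound target-bound
  where open OrderOfEdgeDivisor bic x~y k>0 kδ≡Lσ
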